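{- If $\mathbb{F}=(W,\nu)$ is an n-frame, then $\mathbb{F}^\star=(W,\mathcal{P}(W),R_\ni,R_{\not\ni},R_\nu,R_{\nu^c})$ is a supported two-sorted n-frame.
   Context: An n-frame is a pair $(W,\nu)$ with $W$ a nonempty set and $\nu:W\to\mathcal{P}(\mathcal{P}(W))$ such that each $\nu(w)$ is upward closed under $\subseteq$. For such $\mathbb{F}$, $\mathbb{F}^\star=(W,\mathcal{P}(W),R_\ni,R_{\not\ni},R_\nu,R_{\nu^c})$ where for $x\in W$, $Z\subseteq W$: $ZR_\ni x$ iff $x\in Z$; $ZR_{\not\ni}x$ iff $x\notin Z$; $xR_\nu Z$ iff $Z\in\nu(x)$; $xR_{\nu^c}Z$ iff $Z\notin\nu(x)$. A two-sorted n-frame is $(X,Y,R_\ni,R_{\not\ni},R_\nu,R_{\nu^c})$ with $X,Y$ nonempty, $R_\ni,R_{\not\ni}\subseteq Y\times X$, $R_\nu,R_{\nu^c}\subseteq X\times Y$; it is supported if for every $D\subseteq X$: $R_\nu^{ -1}[(R_\ni^{ -1}[D^c])^c]=(R_{\nu^c}^{ -1}[(R_{\not\ni}^{ -1}[D])^c])^c$, where $R^{ -1}[T']=\{s\mid\exists t\in T',\ sRt\}$ and $(\cdot)^c$ denotes complement. -}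

module Defs where

open import Level using (Level; _⊔_; 0ℓ) renaming (suc to lsuc)
open import Data.Product using (Σ; ∃; _×_; _,_)
open import Relation.Unary using (Pred; _⊆_; _∈_; _∉_; ∁; _≐_)
open import Relation.Binary.Core using (REL)

𝒫 : ∀ {a} → Set a → Set (a ⊔ lsuc 0ℓ)
𝒫 A = Pred A 0ℓ

record IsNFrame (W : Set) (ν : W → Pred (𝒫 W) 0ℓ) : Set₁ where
  field
    nonempty  : W
    upClosed  : ∀ (w : W) {Z Z′ : 𝒫 W} → Z ∈ ν w → Z ⊆ Z′ → Z′ ∈ ν w

_⁻¹[_] : ∀ {a b ℓ ℓ′} {S : Set a} {T : Set b} →
         REL S T ℓ → Pred T ℓ′ → Pred S (b ⊔ ℓ ⊔ ℓ′)
(R ⁻¹[ T′ ]) s = ∃ λ t → t ∈ T′ × R s t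

record IsTwoSortedNFrame {a b} (X : Set a) (Y : Set b)
         (R∋ R∌ : REL Y X 0ℓ) (Rν Rνᶜ : REL X Y 0ℓ) : Set (a ⊔ b) where
  field
    nonemptyX : X
    nonemptyY : Y

IsSupported : ∀ {a b} (X : Set a) (Y : Set b)
              (R∋ R∌ : REL Y X 0ℓ) (Rν Rνᶜ : REL X Y 0ℓ) → Set (a ⊔ b ⊔ lsuc 0ℓ)
IsSupported X Y R∋ R∌ Rν Rνᶜ =
  ∀ (D : 𝒫 X) → Rν ⁻¹[ ∁ (R∋ ⁻¹[ ∁ D ]) ] ≐ ∁ (Rνᶜ ⁻¹[ ∁ (R∌ ⁻¹[ D ]) ])

record IsSupportedTwoSortedNFrame {a b} (X : Set a) (Y : Set b)
         (R∋ R∌ : REL Y X 0ℓ) (Rν Rνᶜ : REL X Y 0ℓ) : Set (a ⊔ b ⊔ lsuc 0ℓ) where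
  field
    isTwoSortedNFrame : IsTwoSortedNFrame X Y R∋ R∌ Rν Rνᶜ
    supported         : IsSupported X Y R∋ R∌ Rν Rνᶜ

module Star (W : Set) (ν : W → Pred (𝒫 W) 0ℓ) where
  R∋ : REL (𝒫 W) W 0ℓ
  R∋ Z x = x ∈ Z
  R∌ : REL (𝒫 W) W 0ℓ
  R∌ Z x = x ∉ Z
  Rν : REL W (𝒫 W) 0ℓ
  Rν x Z = Z ∈ ν x
  Rνᶜ : REL W (𝒫 W) 0ℓ
  Rνᶜ x Z = Z ∉ ν x

module Submission where

open import Defs
open import Level using (Level; 0ℓ)
open import Relation.Unary using (Pred; ∁; ∅; _⊆_; _∈_; _∉_)
open import Axiom.ExcludedMiddle using (ExcludedMiddle)
open import Data.Product using (_,_)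
open import Relation.Nullary using (yes; no)
open import Relation.Nullary.Negation using (contradiction)
open import Function using (id)

-- Classically ∁ (R∋ ⁻¹[ ∁ D ]) is the set of subsets of D and ∁ (R∌ ⁻¹[ D ])
-- the set of supersets of D.  Upward closure of ν x then makes both sides of
-- the supportedness identity equal to { x ∣ D ∈ ν x }.

module _ {W : Set} where

  private
    R∋ R∌ : 𝒫 W → W → Set
    R∋ Z x = x ∈ Z
    R∌ Z x = x ∉ Z

  ⊆⇒∉R∋⁻¹[∁] : ∀ {D Z : 𝒫 W} → Z ⊆ D → Z ∉ R∋ ⁻¹[ ∁ D ]
  ⊆⇒∉R∋⁻¹[∁] Z⊆D (y , y∉D , y∈Z) = y∉D (Z⊆D y∈Z)

  ⊇⇒∉R∌⁻¹ : ∀ {D Z : 𝒫 W} → D ⊆ Z → Z ∉ R∌ ⁻¹[ D ]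
  ⊇⇒∉R∌⁻¹ D⊆Z (y , y∈D , y∉Z) = y∉Z (D⊆Z y∈D)

  module _ (lem : ExcludedMiddle 0ℓ) where

    ∉R∋⁻¹[∁]⇒⊆ : ∀ {D Z : 𝒫 W} → Z ∉ R∋ ⁻¹[ ∁ D ] → Z ⊆ D
    ∉R∋⁻¹[∁]⇒⊆ {D} Z∉ {y} y∈Z with lem {D y}
    ... | yes y∈D = y∈D
    ... | no  y∉D = contradiction (y , y∉D , y∈Z) Z∉

    ∉R∌⁻¹⇒⊇ : ∀ {D Z : 𝒫 W} → Z ∉ R∌ ⁻¹[ D ] → D ⊆ Z
    ∉R∌⁻¹⇒⊇ {Z = Z} Z∉ {y} y∈D with lem {Z y}
    ... | yes y∈Z = y∈Z
    ... | no  y∉Z = contradiction (y , y∈D , y∉Z) Z∉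

isSupported-⋆ : (lem : ExcludedMiddle 0ℓ) (W : Set) (ν : W → Pred (𝒫 W) 0ℓ) →
                IsNFrame W ν →
                IsSupported W (𝒫 W) (Star.R∋ W ν) (Star.R∌ W ν) (Star.Rν W ν) (Star.Rνᶜ W ν)
isSupported-⋆ lem W ν fr D = lhs⊆rhs , rhs⊆lhs
  where
  open IsNFrame fr using (upClosed)
  open Star W ν

  lhs⊆rhs : Rν ⁻¹[ ∁ (R∋ ⁻¹[ ∁ D ]) ] ⊆ ∁ (Rνᶜ ⁻¹[ ∁ (R∌ ⁻¹[ D ]) ])
  lhs⊆rhs {x} (Z , Z∉ , Z∈νx) (Z′ , Z′∉ , Z′∉νx) =
    Z′∉νx (upClosed x Z∈νx (λ y∈Z → ∉R∌⁻¹⇒⊇ lem Z′∉ (∉R∋⁻¹[∁]⇒⊆ lem Z∉ y∈Z)))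

  rhs⊆lhs : ∁ (Rνᶜ ⁻¹[ ∁ (R∌ ⁻¹[ D ]) ]) ⊆ Rν ⁻¹[ ∁ (R∋ ⁻¹[ ∁ D ]) ]
  rhs⊆lhs {x} noWitness with lem {D ∈ ν x}
  ... | yes D∈νx = D , ⊆⇒∉R∋⁻¹[∁] id , D∈νx
  ... | no  D∉νx = contradiction (D , ⊇⇒∉R∌⁻¹ id , D∉νx) noWitness

mainTheorem7 : (lem : ∀ {ℓ : Level} → ExcludedMiddle ℓ)
               (W : Set) (ν : W → Pred (𝒫 W) 0ℓ) → IsNFrame W ν →
               IsSupportedTwoSortedNFrame W (𝒫 W)
                 (Star.R∋ W ν) (Star.R∌ W ν) (Star.Rν W ν) (Star.Rνᶜ W ν)
mainTheorem7 lem W ν fr = record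
  { isTwoSortedNFrame = record { nonemptyX = IsNFrame.nonempty fr ; nonemptyY = ∅ }
  ; supported         = isSupported-⋆ lem W ν fr
  }
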